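{- Let $G$ be a finite simple König–Egerváry graph with $n$ vertices. Then the following are equivalent: (i) $\alpha(G)>n/2$; (ii) $G$ has no perfect matching; (iii) $G$ is not quasi-regularizable; (iv) $|core(G)|>|N(core(G))|$.
   Context: $\alpha(G)$ is the maximum size of a stable set, $\mu(G)$ the maximum size of a matching; $G$ is König–Egerváry if $\alpha(G)+\mu(G)=|V(G)|$. $\Omega(G)$ is the set of maximum stable sets, $core(G)=\bigcap\{S:S\in\Omega(G)\}$, and for $A\subseteq V(G)$, $N(A)$ is the set of vertices adjacent to some vertex of $A$. $G$ is quasi-regularizable if one can replace each edge of $G$ by a non-negative integer number of parallel copies so as to obtain a regular multigraph of nonzero degree. -}

module Defs where

open import Data.Nat using (ℕ; zero; suc; _+_; _*_; _≤_; _<_)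
open import Data.Fin using (Fin)
open import Data.Fin.Subset using (Subset; _∈_; ∣_∣)
open import Data.List using (List; []; _∷_; length; tabulate; concatMap)
open import Data.Nat.ListAction using (sum)
open import Data.List.Relation.Unary.All using (All)
open import Data.List.Relation.Unary.Unique.Propositional using (Unique)
import Data.List.Membership.Propositional as LM
open import Data.Product using (Σ; ∃; _×_; _,_; proj₁; proj₂)
open import Relation.Nullary using (¬_; Dec)
open import Relation.Binary.PropositionalEquality using (_≡_)
open import Function.Bundles using (_⇔_)

record SimpleGraph (n : ℕ) : Set₁ where
  field
    Adj     : Fin n → Fin n → Set
    adj-dec : ∀ u v → Dec (Adj u v)
    sym     : ∀ {u v} → Adj u v → Adj v u
    irrefl  : ∀ {u} → ¬ Adj u u

module _ {n : ℕ} (G : SimpleGraph n) where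
  open SimpleGraph G

  IsStable : Subset n → Set
  IsStable S = ∀ u v → u ∈ S → v ∈ S → ¬ Adj u v

  IsMaxStable : Subset n → Set
  IsMaxStable S = IsStable S × (∀ T → IsStable T → ∣ T ∣ ≤ ∣ S ∣)

  IsAlpha : ℕ → Set
  IsAlpha k = (Σ (Subset n) λ S → IsStable S × ∣ S ∣ ≡ k)
            × (∀ S → IsStable S → ∣ S ∣ ≤ k)

  endpoints : List (Fin n × Fin n) → List (Fin n)
  endpoints = concatMap (λ e → proj₁ e ∷ proj₂ e ∷ [])

  IsMatching : List (Fin n × Fin n) → Set
  IsMatching M = All (λ e → Adj (proj₁ e) (proj₂ e)) M × Unique (endpoints M)

  IsMu : ℕ → Set
  IsMu k = (Σ (List (Fin n × Fin n)) λ M → IsMatching M × length M ≡ k)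
         × (∀ M → IsMatching M → length M ≤ k)

  HasPerfectMatching : Set
  HasPerfectMatching =
    Σ (List (Fin n × Fin n)) λ M → IsMatching M × (∀ v → v LM.∈ endpoints M)

  IsKE : Set
  IsKE = ∀ a m → IsAlpha a → IsMu m → a + m ≡ n

  IsCore : Subset n → Set
  IsCore C = ∀ v → (v ∈ C) ⇔ (∀ S → IsMaxStable S → v ∈ S)

  IsNeighbourhood : Subset n → Subset n → Set
  IsNeighbourhood A D = ∀ v → (v ∈ D) ⇔ (Σ (Fin n) λ u → u ∈ A × Adj u v)

  -- quasi-regularizable: nonnegative integer multiplicities on the edges
  -- (symmetric, zero on non-edges) giving a d-regular multigraph, d ≥ 1
  QuasiRegularizable : Set
  QuasiRegularizable =
    Σ (Fin n → Fin n → ℕ) λ w →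
      (∀ u v → w u v ≡ w v u)
    × (∀ u v → ¬ Adj u v → w u v ≡ 0)
    × Σ ℕ λ d → 1 ≤ d × (∀ v → sum (tabulate (w v)) ≡ d)

{-# OPTIONS --safe #-}
module Submission where

-- A symmetric weighting w of the edges gives, by counting every edge from both ends,
-- Σₓ f x · deg x ≤ Σ_z g z · deg z whenever f x ≤ g z along each edge xz of positive
-- weight. For the d-regular weighting of a quasi-regularizable graph this becomes
-- |A| ≤ |B| whenever every edge leaving A enters B; hence α ≤ n/2 and
-- |core| ≤ |N(core)|, while a perfect matching is itself a 1-regular weighting.
-- Now let M be a maximum matching of a König–Egerváry graph and T a maximum stable set.
-- The complement of T has exactly μ = |M| vertices, each matched at most once, and
-- receives at least half of the 2μ matched endpoints since T is stable; so every edge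
-- of M has one end in T and every unmatched vertex lies in T. Consequently unmatched
-- vertices lie in the core and M matches N(core) into the core. Finally α + μ = n turns
-- α > n/2 into μ < n/2, which is the absence of a perfect matching and leaves some vertex
-- unmatched, whence |N(core)| < |core|.

open import Defs
open import Data.Bool.Base using (true; false; if_then_else_)
open import Data.Fin.Base using (Fin; zero; suc)
open import Data.Fin.Properties as Fin using (any?)
open import Data.Fin.Subset using (Subset; _∈_; _∉_; ∣_∣; ∁; ⁅_⁆)
open import Data.Fin.Subset.Properties
  using (_∈?_; x∈p⇒x∉∁p; x∉p⇒x∈∁p; ∣∁p∣≡n∸∣p∣; ∣p∣≤n; x∈⁅x⁆; x∈⁅y⁆⇒x≡y; x≢y⇒x∉⁅y⁆; ∣⁅x⁆∣≡1)
open import Data.List.Base using (List; []; _∷_; length; tabulate)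
import Data.List.Membership.DecPropositional as DecMembership
import Data.List.Membership.Propositional as LM
open import Data.List.Relation.Unary.All using (All; []; _∷_; all?)
open import Data.List.Relation.Unary.All.Properties using (All¬⇒¬Any)
open import Data.List.Relation.Unary.AllPairs using (_∷_)
import Data.List.Relation.Unary.AllPairs as AllPairs
open import Data.List.Relation.Unary.Any using (here; there)
open import Data.List.Relation.Unary.Unique.Propositional using (Unique)
import Data.List.Relation.Unary.Unique.DecPropositional as DecUnique
open import Data.Nat.Base using (ℕ; zero; suc; _+_; _*_; _≤_; _<_; z≤n; s≤s; z<s; >-nonZero)
import Data.Nat.ListAction as ListAction
open import Data.Nat.Properties
open import Algebra.Properties.Semiring.Sum +-*-semiring
  using (sum; sum-replicate-zero; sum-cong-≗; ∑-distrib-+; ∑-comm; *-distribˡ-sum)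
open import Data.Product using (∃; ∃-syntax; _×_; _,_; proj₁; proj₂; swap)
open import Data.Sum.Base using (inj₁; inj₂)
open import Data.Vec.Base using ([]; _∷_; lookup)
open import Data.Vec.Properties using ([]=⇒lookup; lookup⇒[]=)
open import Function.Base using (_∘_; case_of_)
open import Function.Bundles using (_⇔_; mk⇔; Equivalence)
open import Relation.Binary.PropositionalEquality
  using (_≡_; refl; sym; trans; cong; cong₂; subst; subst₂; module ≡-Reasoning)
open import Relation.Nullary using (¬_; Dec; yes; no; contradiction)
open import Relation.Nullary.Decidable using (_×-dec_)

private
  variable
    n : ℕ
    p q : Subset n
    x z : Fin n

2*m≡m+m : ∀ m → 2 * m ≡ m + m
2*m≡m+m m = cong (m +_) (+-identityʳ m)

n<2*a⇔m+m<n : ∀ {a m n} → a + m ≡ n → (n < 2 * a) ⇔ (m + m < n)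
n<2*a⇔m+m<n {a} {m} refl = mk⇔
  (λ n<2a → +-monoˡ-< m (+-cancelˡ-< a m a (subst (a + m <_) (2*m≡m+m a) n<2a)))
  (λ 2m<n → subst (a + m <_) (sym (2*m≡m+m a)) (+-monoʳ-< a (+-cancelʳ-< m m a 2m<n)))

+-squeeze : ∀ {x y m} → x ≤ y → y ≤ m → x + y ≡ m + m → x ≡ y × y ≡ m
+-squeeze {x} {y} {m} x≤y y≤m x+y≡2m = x≡y , y≡m
  where
  y≡m : y ≡ m
  y≡m = ≤-antisym y≤m (≮⇒≥ (λ y<m → <-irrefl x+y≡2m (+-mono-< (≤-<-trans x≤y y<m) y<m)))
  x≡y : x ≡ y
  x≡y = +-cancelʳ-≡ y x y (trans x+y≡2m (cong₂ _+_ (sym y≡m) (sym y≡m)))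

sum-tabulate : (f : Fin n → ℕ) → ListAction.sum (tabulate f) ≡ sum f
sum-tabulate {zero}  f = refl
sum-tabulate {suc n} f = cong (f zero +_) (sum-tabulate (f ∘ suc))

sum-replicate-1 : ∀ n → sum {n} (λ _ → 1) ≡ n
sum-replicate-1 zero    = refl
sum-replicate-1 (suc n) = cong suc (sum-replicate-1 n)

sum-mono-≤ : {f g : Fin n → ℕ} → (∀ i → f i ≤ g i) → sum f ≤ sum g
sum-mono-≤ {zero}  f≤g = z≤n
sum-mono-≤ {suc n} f≤g = +-mono-≤ (f≤g zero) (sum-mono-≤ (f≤g ∘ suc))

sum-mono-< : {f g : Fin n → ℕ} → (∀ i → f i ≤ g i) → ∀ k → f k < g k → sum f < sum g
sum-mono-< f≤g zero    fk<gk = +-mono-<-≤ fk<gk (sum-mono-≤ (f≤g ∘ suc))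
sum-mono-< f≤g (suc k) fk<gk = +-mono-≤-< (f≤g zero) (sum-mono-< (f≤g ∘ suc) k fk<gk)

sum<sum⇒∃< : {f g : Fin n → ℕ} → sum f < sum g → ∃ λ i → f i < g i
sum<sum⇒∃< {f = f} {g} ∑f<∑g with any? (λ i → f i <? g i)
... | yes found = found
... | no  none  = contradiction (sum-mono-≤ (λ i → ≮⇒≥ (λ fi<gi → none (i , fi<gi)))) (<⇒≱ ∑f<∑g)

χ : Subset n → Fin n → ℕ
χ p x = if lookup p x then 1 else 0

χ-∈ : x ∈ p → χ p x ≡ 1
χ-∈ x∈p = cong (λ b → if b then 1 else 0) ([]=⇒lookup x∈p)

χ-∉ : x ∉ p → χ p x ≡ 0
χ-∉ {x = x} {p = p} x∉p with lookup p x in eq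
... | true  = contradiction (lookup⇒[]= x p eq) x∉p
... | false = refl

χ+χ∁≡1 : χ p x + χ (∁ p) x ≡ 1
χ+χ∁≡1 {p = p} {x = x} with x ∈? p
... | yes x∈p = cong₂ _+_ (χ-∈ x∈p) (χ-∉ (x∈p⇒x∉∁p x∈p))
... | no  x∉p = cong₂ _+_ (χ-∉ x∉p) (χ-∈ (x∉p⇒x∈∁p x∉p))

χ-mono : (x ∈ p → z ∈ q) → χ p x ≤ χ q z
χ-mono {x = x} {p = p} x∈p⇒z∈q with x ∈? p
... | yes x∈p = ≤-reflexive (trans (χ-∈ x∈p) (sym (χ-∈ (x∈p⇒z∈q x∈p))))
... | no  x∉p = ≤-trans (≤-reflexive (χ-∉ x∉p)) z≤n

sum-χ : (p : Subset n) → sum (χ p) ≡ ∣ p ∣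
sum-χ []          = refl
sum-χ (true  ∷ p) = cong suc (sum-χ p)
sum-χ (false ∷ p) = sum-χ p

∣p∣+∣∁p∣≡n : (p : Subset n) → ∣ p ∣ + ∣ ∁ p ∣ ≡ n
∣p∣+∣∁p∣≡n p = trans (cong (∣ p ∣ +_) (∣∁p∣≡n∸∣p∣ p)) (m+[n∸m]≡n (∣p∣≤n p))

χ≤χ*f : {f : Fin n → ℕ} → (∀ {y} → y ∈ p → 0 < f y) → ∀ x → χ p x ≤ χ p x * f x
χ≤χ*f {p = p} {f = f} f>0 x with x ∈? p
... | yes x∈p = m≤m*n (χ p x) (f x) {{>-nonZero (f>0 x∈p)}}
... | no  x∉p = subst (λ c → c ≤ c * f x) (sym (χ-∉ x∉p)) z≤n

n≤1⇒m*n≤m : ∀ {m n} → n ≤ 1 → m * n ≤ m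
n≤1⇒m*n≤m {m} n≤1 = ≤-trans (*-monoʳ-≤ m n≤1) (≤-reflexive (*-identityʳ m))

-- Double counting along a symmetric edge weighting

degree : (Fin n → Fin n → ℕ) → Fin n → ℕ
degree w x = sum (w x)

*-monoˡ-≤-on-support : ∀ {a b} c → (0 < c → a ≤ b) → a * c ≤ b * c
*-monoˡ-≤-on-support {a} {b} zero    _   = ≤-reflexive (trans (*-zeroʳ a) (sym (*-zeroʳ b)))
*-monoˡ-≤-on-support         (suc c) a≤b = *-monoˡ-≤ (suc c) (a≤b z<s)

module _ (w : Fin n → Fin n → ℕ) (w-sym : ∀ u v → w u v ≡ w v u) {f g : Fin n → ℕ} where

  private
    ∑f*degree≡∑∑ : sum (λ x → f x * degree w x) ≡ sum (λ x → sum (λ z → f x * w x z))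
    ∑f*degree≡∑∑ = sum-cong-≗ (λ x → *-distribˡ-sum (f x) (w x))

    ∑g*degree≡∑∑ : sum (λ z → g z * degree w z) ≡ sum (λ x → sum (λ z → g z * w x z))
    ∑g*degree≡∑∑ = begin
      sum (λ z → g z * degree w z)             ≡⟨ sum-cong-≗ (λ z → *-distribˡ-sum (g z) (w z)) ⟩
      sum (λ z → sum (λ x → g z * w z x))
        ≡⟨ sum-cong-≗ (λ z → sum-cong-≗ (λ x → cong (g z *_) (w-sym z x))) ⟩
      sum (λ z → sum (λ x → g z * w x z))      ≡⟨ ∑-comm (λ z x → g z * w x z) ⟩
      sum (λ x → sum (λ z → g z * w x z))      ∎
      where open ≡-Reasoning

  -- Both sides are Σₓ Σ_z of the weight w x z times f x, resp. g z (using w x z ≡ w z x).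
  sum-*degree-mono-≤ : (∀ x z → 0 < w x z → f x ≤ g z) →
    sum (λ x → f x * degree w x) ≤ sum (λ z → g z * degree w z)
  sum-*degree-mono-≤ f≤g = subst₂ _≤_ (sym ∑f*degree≡∑∑) (sym ∑g*degree≡∑∑)
    (sum-mono-≤ (λ x → sum-mono-≤ (λ z → *-monoˡ-≤-on-support (w x z) (f≤g x z))))

  sum-*degree-mono-< : (∀ x z → 0 < w x z → f x ≤ g z) →
    ∀ x₀ z₀ → 0 < w x₀ z₀ → f x₀ < g z₀ →
    sum (λ x → f x * degree w x) < sum (λ z → g z * degree w z)
  sum-*degree-mono-< f≤g x₀ z₀ w>0 f<g = subst₂ _<_ (sym ∑f*degree≡∑∑) (sym ∑g*degree≡∑∑)
    (sum-mono-< (λ x → sum-mono-≤ (λ z → *-monoˡ-≤-on-support (w x z) (f≤g x z))) x₀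
      (sum-mono-< (λ z → *-monoˡ-≤-on-support (w x₀ z) (f≤g x₀ z)) z₀
        (*-monoˡ-< (w x₀ z₀) {{>-nonZero w>0}} f<g)))

occurrences : Fin n → List (Fin n) → ℕ
occurrences u []       = 0
occurrences u (x ∷ xs) = χ ⁅ x ⁆ u + occurrences u xs

sum-χ⁅⁆ : (x : Fin n) → sum (χ ⁅ x ⁆) ≡ 1
sum-χ⁅⁆ x = trans (sum-χ ⁅ x ⁆) (∣⁅x⁆∣≡1 x)

sum-occurrences : (xs : List (Fin n)) → sum (λ u → occurrences u xs) ≡ length xs
sum-occurrences {n} []  = sum-replicate-zero n
sum-occurrences (x ∷ xs) = trans (∑-distrib-+ (χ ⁅ x ⁆) (λ u → occurrences u xs))
                                 (cong₂ _+_ (sum-χ⁅⁆ x) (sum-occurrences xs))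

occurrences-∉ : {u : Fin n} (xs : List (Fin n)) → ¬ u LM.∈ xs → occurrences u xs ≡ 0
occurrences-∉ []       _    = refl
occurrences-∉ (x ∷ xs) u∉xs =
  cong₂ _+_ (χ-∉ (x≢y⇒x∉⁅y⁆ (u∉xs ∘ here))) (occurrences-∉ xs (u∉xs ∘ there))

occurrences-∈ : {u : Fin n} {xs : List (Fin n)} → u LM.∈ xs → 1 ≤ occurrences u xs
occurrences-∈ {u = u} (here refl) = ≤-trans (≤-reflexive (sym (χ-∈ (x∈⁅x⁆ u)))) (m≤m+n _ _)
occurrences-∈ {xs = x ∷ _} (there u∈xs) = ≤-trans (occurrences-∈ u∈xs) (m≤n+m _ (χ ⁅ x ⁆ _))

occurrences≤1 : {u : Fin n} {xs : List (Fin n)} → Unique xs → occurrences u xs ≤ 1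
occurrences≤1 {xs = []} _ = z≤n
occurrences≤1 {u = u} {xs = x ∷ xs} (x∉xs ∷ unique) with u ∈? ⁅ x ⁆
... | yes u∈⁅x⁆ rewrite x∈⁅y⁆⇒x≡y x u∈⁅x⁆ =
  ≤-reflexive (cong₂ _+_ (χ-∈ (x∈⁅x⁆ x)) (occurrences-∉ xs (All¬⇒¬Any x∉xs)))
... | no  u∉⁅x⁆ rewrite χ-∉ u∉⁅x⁆ = occurrences≤1 unique

any-pair? : {P : Fin n × Fin n → Set} → (∀ e → Dec (P e)) → Dec (∃ P)
any-pair? P? with any? (λ a → any? (λ b → P? (a , b)))
... | yes (a , b , pab) = yes ((a , b) , pab)
... | no  none          = no (λ ((a , b) , pab) → none (a , b , pab))

any-ofLength? : {A : Set} → (∀ {P : A → Set} → (∀ x → Dec (P x)) → Dec (∃ P)) →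
  ∀ k {Q : List A → Set} → (∀ xs → Dec (Q xs)) → Dec (∃[ xs ] Q xs × length xs ≡ k)
any-ofLength? any-A? zero    Q? with Q? []
... | yes q = yes ([] , q , refl)
... | no ¬q = no (λ { ([] , q , _) → ¬q q })
any-ofLength? any-A? (suc k) Q? with any-A? (λ x → any-ofLength? any-A? k (λ xs → Q? (x ∷ xs)))
... | yes (x , xs , q , refl) = yes (x ∷ xs , q , refl)
... | no  none                = no (λ { (x ∷ xs , q , refl) → none (x , xs , q , refl) })

largest≤ : {P : ℕ → Set} → (∀ k → Dec (P k)) → P 0 → ∀ bound →
  ∃[ j ] P j × (∀ i → i ≤ bound → P i → i ≤ j)
largest≤ P? P0 zero = 0 , P0 , λ _ i≤0 _ → i≤0
largest≤ P? P0 (suc bound) with P? (suc bound)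
... | yes Pb = suc bound , Pb , λ _ i≤b _ → i≤b
... | no ¬Pb =
  let j , Pj , largest = largest≤ P? P0 bound
  in  j , Pj , λ i i≤1+b Pi → case m≤n⇒m<n∨m≡n i≤1+b of λ
        { (inj₁ i<1+b) → largest i (≤-pred i<1+b) Pi
        ; (inj₂ refl)  → contradiction Pi ¬Pb }

-- Edge weightings, quasi-regularity and matchings

χ-pair : Fin n × Fin n → Fin n → Fin n → ℕ
χ-pair (a , b) u v = χ ⁅ a ⁆ u * χ ⁅ b ⁆ v

sum-χ-pair : ∀ a b (u : Fin n) → sum (χ-pair (a , b) u) ≡ χ ⁅ a ⁆ u
sum-χ-pair a b u = begin
  sum (λ v → χ ⁅ a ⁆ u * χ ⁅ b ⁆ v) ≡⟨ *-distribˡ-sum (χ ⁅ a ⁆ u) (χ ⁅ b ⁆) ⟨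
  χ ⁅ a ⁆ u * sum (χ ⁅ b ⁆)         ≡⟨ cong (χ ⁅ a ⁆ u *_) (sum-χ⁅⁆ b) ⟩
  χ ⁅ a ⁆ u * 1                     ≡⟨ *-identityʳ _ ⟩
  χ ⁅ a ⁆ u                         ∎
  where open ≡-Reasoning

χ-pair≡0 : ∀ {a b u v : Fin n} → ¬ (u ≡ a × v ≡ b) → χ-pair (a , b) u v ≡ 0
χ-pair≡0 {a = a} {b} {u} {v} ≢ab with u ∈? ⁅ a ⁆ | v ∈? ⁅ b ⁆
... | yes u∈⁅a⁆ | yes v∈⁅b⁆ = contradiction (x∈⁅y⁆⇒x≡y a u∈⁅a⁆ , x∈⁅y⁆⇒x≡y b v∈⁅b⁆) ≢ab
... | no  u∉⁅a⁆ | _         = cong (_* χ ⁅ b ⁆ v) (χ-∉ u∉⁅a⁆)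
... | yes _     | no v∉⁅b⁆  = trans (cong (χ ⁅ a ⁆ u *_) (χ-∉ v∉⁅b⁆)) (*-zeroʳ (χ ⁅ a ⁆ u))

multiplicity : List (Fin n × Fin n) → Fin n → Fin n → ℕ
multiplicity []       u v = 0
multiplicity (e ∷ es) u v = χ-pair e u v + χ-pair (swap e) u v + multiplicity es u v

multiplicity-sym : (es : List (Fin n × Fin n)) → ∀ u v → multiplicity es u v ≡ multiplicity es v u
multiplicity-sym []             u v = refl
multiplicity-sym ((a , b) ∷ es) u v = cong₂ _+_
  (trans (+-comm (χ-pair (a , b) u v) _) (cong₂ _+_ (*-comm (χ ⁅ b ⁆ u) _) (*-comm (χ ⁅ a ⁆ u) _)))
  (multiplicity-sym es u v)

module _ {n} (G : SimpleGraph n) where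

  open SimpleGraph G renaming (sym to Adj-sym)
  open DecMembership (Fin._≟_ {n}) using () renaming (_∈?_ to _∈ₗ?_)

  IsMaximumMatching : List (Fin n × Fin n) → Set
  IsMaximumMatching M = IsMatching G M × (∀ M′ → IsMatching G M′ → length M′ ≤ length M)

  support⇒Adj : {w : Fin n → Fin n → ℕ} → (∀ u v → ¬ Adj u v → w u v ≡ 0) →
    ∀ {u v} → 0 < w u v → Adj u v
  support⇒Adj w-support {u} {v} w>0 with adj-dec u v
  ... | yes adj = adj
  ... | no ¬adj = contradiction (w-support u v ¬adj) (m<n⇒n≢0 w>0)

  stable⇒Adj⇒∈∁ : {p : Subset n} → IsStable G p → ∀ {x z} → Adj x z → x ∈ p → z ∈ ∁ p
  stable⇒Adj⇒∈∁ p-stable {x} {z} adj x∈p = x∉p⇒x∈∁p (λ z∈p → p-stable x z x∈p z∈p adj)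

  quasiRegularizable⇒∣p∣≤∣q∣ : {p q : Subset n} → QuasiRegularizable G →
    (∀ {x z} → Adj x z → x ∈ p → z ∈ q) → ∣ p ∣ ≤ ∣ q ∣
  quasiRegularizable⇒∣p∣≤∣q∣ {p} {q} (w , w-sym , w-support , d , d>0 , regular) p→q =
    *-cancelˡ-≤ d {{>-nonZero d>0}} (begin
      d * ∣ p ∣                       ≡⟨ weighted p ⟨
      sum (λ x → χ p x * degree w x)  ≤⟨ sum-*degree-mono-≤ w w-sym
                                            (λ x z w>0 → χ-mono (p→q (support⇒Adj w-support w>0))) ⟩
      sum (λ z → χ q z * degree w z)  ≡⟨ weighted q ⟩
      d * ∣ q ∣                       ∎)
    where
    open ≤-Reasoning
    weighted : ∀ r → sum (λ x → χ r x * degree w x) ≡ d * ∣ r ∣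
    weighted r = begin-equality
      sum (λ x → χ r x * degree w x)
        ≡⟨ sum-cong-≗ (λ x → cong (χ r x *_) (trans (sym (sum-tabulate (w x))) (regular x))) ⟩
      sum (λ x → χ r x * d)          ≡⟨ sum-cong-≗ (λ x → *-comm (χ r x) d) ⟩
      sum (λ x → d * χ r x)          ≡⟨ *-distribˡ-sum d (χ r) ⟨
      d * sum (χ r)                  ≡⟨ cong (d *_) (sum-χ r) ⟩
      d * ∣ r ∣                      ∎

  quasiRegularizable⇒2∣stable∣≤n : {p : Subset n} → QuasiRegularizable G → IsStable G p →
    2 * ∣ p ∣ ≤ n
  quasiRegularizable⇒2∣stable∣≤n {p} qr p-stable = begin
    2 * ∣ p ∣        ≡⟨ 2*m≡m+m ∣ p ∣ ⟩
    ∣ p ∣ + ∣ p ∣    ≤⟨ +-monoʳ-≤ ∣ p ∣ (quasiRegularizable⇒∣p∣≤∣q∣ qr (stable⇒Adj⇒∈∁ p-stable)) ⟩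
    ∣ p ∣ + ∣ ∁ p ∣  ≡⟨ ∣p∣+∣∁p∣≡n p ⟩
    n                ∎
    where open ≤-Reasoning

  quasiRegularizable⇒2α≤n : ∀ {a} → IsAlpha G a → QuasiRegularizable G → 2 * a ≤ n
  quasiRegularizable⇒2α≤n ((S , S-stable , refl) , _) qr =
    quasiRegularizable⇒2∣stable∣≤n qr S-stable

  quasiRegularizable⇒∣p∣≤∣N[p]∣ : ∀ {p q} → QuasiRegularizable G → IsNeighbourhood G p q →
    ∣ p ∣ ≤ ∣ q ∣
  quasiRegularizable⇒∣p∣≤∣N[p]∣ qr q-nbhd =
    quasiRegularizable⇒∣p∣≤∣q∣ qr (λ {x} {z} adj x∈p → Equivalence.from (q-nbhd z) (x , x∈p , adj))

  α⇒maxStable : ∀ {a} → IsAlpha G a → ∃ (IsMaxStable G)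
  α⇒maxStable ((S , S-stable , refl) , α-max) = S , S-stable , α-max

  maxStable-size : ∀ {a T} → IsAlpha G a → IsMaxStable G T → ∣ T ∣ ≡ a
  maxStable-size {T = T} ((S , S-stable , refl) , α-max) (T-stable , T-max) =
    ≤-antisym (α-max T T-stable) (T-max S S-stable)

  module _ {C} (C-core : IsCore G C) where

    ∈core : ∀ {u} → (∀ {T} → IsMaxStable G T → u ∈ T) → u ∈ C
    ∈core {u} ∈maxStable = Equivalence.from (C-core u) (λ _ T-max → ∈maxStable T-max)

    core⊆maxStable : ∀ {u T} → u ∈ C → IsMaxStable G T → u ∈ T
    core⊆maxStable {u} {T} u∈C = Equivalence.to (C-core u) u∈C T

    N[core]∩maxStable≡∅ : ∀ {D y T} → IsNeighbourhood G C D → y ∈ D → IsMaxStable G T → y ∉ T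
    N[core]∩maxStable≡∅ {y = y} D-nbhd y∈D T-max y∈T =
      let c , c∈C , adj = Equivalence.to (D-nbhd y) y∈D
      in  proj₁ T-max c y (core⊆maxStable c∈C T-max) y∈T adj

  length-endpoints : ∀ es → length (endpoints G es) ≡ length es + length es
  length-endpoints []       = refl
  length-endpoints (e ∷ es) = cong suc (trans (cong suc (length-endpoints es)) (sym (+-suc _ _)))

  degree-multiplicity : ∀ es u → degree (multiplicity es) u ≡ occurrences u (endpoints G es)
  degree-multiplicity []             u = sum-replicate-zero n
  degree-multiplicity ((a , b) ∷ es) u = begin
    sum (λ v → χ-pair (a , b) u v + χ-pair (b , a) u v + multiplicity es u v)
      ≡⟨ ∑-distrib-+ (λ v → χ-pair (a , b) u v + χ-pair (b , a) u v) (multiplicity es u) ⟩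
    sum (λ v → χ-pair (a , b) u v + χ-pair (b , a) u v) + degree (multiplicity es) u
      ≡⟨ cong₂ _+_ (∑-distrib-+ (χ-pair (a , b) u) (χ-pair (b , a) u)) (degree-multiplicity es u) ⟩
    sum (χ-pair (a , b) u) + sum (χ-pair (b , a) u) + occurrences u (endpoints G es)
      ≡⟨ cong (_+ occurrences u (endpoints G es))
              (cong₂ _+_ (sum-χ-pair a b u) (sum-χ-pair b a u)) ⟩
    χ ⁅ a ⁆ u + χ ⁅ b ⁆ u + occurrences u (endpoints G es)
      ≡⟨ +-assoc (χ ⁅ a ⁆ u) _ _ ⟩
    χ ⁅ a ⁆ u + (χ ⁅ b ⁆ u + occurrences u (endpoints G es)) ∎
    where open ≡-Reasoning

  sum-degree-multiplicity : ∀ es → sum (degree (multiplicity es)) ≡ length es + length es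
  sum-degree-multiplicity es = trans (sum-cong-≗ (degree-multiplicity es))
    (trans (sum-occurrences (endpoints G es)) (length-endpoints es))

  multiplicity-support : ∀ {es} → All (λ e → Adj (proj₁ e) (proj₂ e)) es →
    ∀ u v → ¬ Adj u v → multiplicity es u v ≡ 0
  multiplicity-support []                       u v ¬adj = refl
  multiplicity-support {(a , b) ∷ _} (adj ∷ adjs) u v ¬adj = cong₂ _+_
    (cong₂ _+_ (χ-pair≡0 (not-this adj)) (χ-pair≡0 (not-this (Adj-sym adj))))
    (multiplicity-support adjs u v ¬adj)
    where
    not-this : ∀ {a b} → Adj a b → ¬ (u ≡ a × v ≡ b)
    not-this adj (refl , refl) = ¬adj adj

  matching-degree≤1 : ∀ {M} → IsMatching G M → ∀ u → degree (multiplicity M) u ≤ 1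
  matching-degree≤1 {M} (_ , unique) u =
    ≤-trans (≤-reflexive (degree-multiplicity M u)) (occurrences≤1 unique)

  endpoint⇒degree≥1 : ∀ {M v} → v LM.∈ endpoints G M → 1 ≤ degree (multiplicity M) v
  endpoint⇒degree≥1 {M} {v} v∈ = subst (1 ≤_) (sym (degree-multiplicity M v)) (occurrences-∈ v∈)

  matching⇒2∣M∣≤n : ∀ {M} → IsMatching G M → length M + length M ≤ n
  matching⇒2∣M∣≤n {M} M-matching = begin
    length M + length M              ≡⟨ sum-degree-multiplicity M ⟨
    sum (degree (multiplicity M))    ≤⟨ sum-mono-≤ (matching-degree≤1 M-matching) ⟩
    sum {n} (λ _ → 1)                ≡⟨ sum-replicate-1 n ⟩
    n                                ∎
    where open ≤-Reasoning

  covering⇒n≤2∣M∣ : ∀ {M} → (∀ v → v LM.∈ endpoints G M) → n ≤ length M + length M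
  covering⇒n≤2∣M∣ {M} covering = begin
    n                                ≡⟨ sum-replicate-1 n ⟨
    sum {n} (λ _ → 1)                ≤⟨ sum-mono-≤ (endpoint⇒degree≥1 {M} ∘ covering) ⟩
    sum (degree (multiplicity M))    ≡⟨ sum-degree-multiplicity M ⟩
    length M + length M              ∎
    where open ≤-Reasoning

  2∣M∣<n⇒unmatched : ∀ {M} → length M + length M < n → ∃ λ u → degree (multiplicity M) u ≡ 0
  2∣M∣<n⇒unmatched {M} 2∣M∣<n =
    let u , degree<1 = sum<sum⇒∃<
          (subst₂ _<_ (sym (sum-degree-multiplicity M)) (sym (sum-replicate-1 n)) 2∣M∣<n)
    in  u , n<1⇒n≡0 degree<1

  n≤2∣M∣⇒covering : ∀ {M} → IsMatching G M → n ≤ length M + length M → ∀ v → v LM.∈ endpoints G M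
  n≤2∣M∣⇒covering {M} M-matching n≤2∣M∣ v with v ∈ₗ? endpoints G M
  ... | yes v∈ = v∈
  ... | no  v∉ = contradiction n≤2∣M∣ (<⇒≱ (begin-strict
    length M + length M              ≡⟨ sum-degree-multiplicity M ⟨
    sum (degree (multiplicity M))    <⟨ sum-mono-< (matching-degree≤1 M-matching) v unmatched ⟩
    sum {n} (λ _ → 1)                ≡⟨ sum-replicate-1 n ⟩
    n                                ∎))
    where
    open ≤-Reasoning
    unmatched : degree (multiplicity M) v < 1
    unmatched = s≤s (≤-reflexive
      (trans (degree-multiplicity M v) (occurrences-∉ (endpoints G M) v∉)))

  perfectMatching⇒quasiRegularizable : HasPerfectMatching G → QuasiRegularizable G
  perfectMatching⇒quasiRegularizable (M , M-matching@(M-edges , _) , covering) =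
    multiplicity M , multiplicity-sym M , multiplicity-support M-edges , 1 , ≤-refl , 1-regular
    where
    1-regular : ∀ v → ListAction.sum (tabulate (multiplicity M v)) ≡ 1
    1-regular v = trans (sum-tabulate (multiplicity M v))
      (≤-antisym (matching-degree≤1 M-matching v) (endpoint⇒degree≥1 {M} (covering v)))

  ¬perfectMatching⇔2∣M∣<n : ∀ {M} → IsMaximumMatching M →
    (¬ HasPerfectMatching G) ⇔ (length M + length M < n)
  ¬perfectMatching⇔2∣M∣<n {M} (M-matching , M-maximum) = mk⇔
    (λ ¬perfect → ≰⇒> (λ n≤2∣M∣ → ¬perfect (M , M-matching , n≤2∣M∣⇒covering M-matching n≤2∣M∣)))
    (λ 2∣M∣<n → λ { (M′ , M′-matching , covering) → <⇒≱ 2∣M∣<n (begin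
      n                      ≤⟨ covering⇒n≤2∣M∣ {M′} covering ⟩
      length M′ + length M′  ≤⟨ +-mono-≤ (M-maximum M′ M′-matching) (M-maximum M′ M′-matching) ⟩
      length M + length M    ∎) })
    where open ≤-Reasoning

  isMatching? : ∀ M → Dec (IsMatching G M)
  isMatching? M =
    all? (λ e → adj-dec (proj₁ e) (proj₂ e)) M ×-dec DecUnique.unique? Fin._≟_ (endpoints G M)

  matchingOfSize? : ∀ k → Dec (∃[ M ] IsMatching G M × length M ≡ k)
  matchingOfSize? k = any-ofLength? any-pair? k isMatching?

  maximumMatching : ∃ IsMaximumMatching
  maximumMatching with largest≤ matchingOfSize? ([] , ([] , AllPairs.[]) , refl) n
  ... | _ , (M , M-matching , refl) , largest = M , M-matching , λ M′ M′-matching →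
    largest (length M′) (≤-trans (m≤m+n _ _) (matching⇒2∣M∣≤n M′-matching))
      (M′ , M′-matching , refl)

-- König–Egerváry graphs

module KönigEgerváry {n} (G : SimpleGraph n) {a} (α : IsAlpha G a)
  {M} (M-matching : IsMatching G M) (a+∣M∣≡n : a + length M ≡ n) where

  private
    w : Fin n → Fin n → ℕ
    w = multiplicity M

    μ : ℕ
    μ = length M

  module _ {T} (T-max : IsMaxStable G T) where

    private
      inside outside : ℕ
      inside  = sum (λ x → χ T x * degree w x)
      outside = sum (λ x → χ (∁ T) x * degree w x)

      ∣∁T∣≡μ : ∣ ∁ T ∣ ≡ μ
      ∣∁T∣≡μ = +-cancelˡ-≡ a _ _ (begin
        a + ∣ ∁ T ∣      ≡⟨ cong (_+ ∣ ∁ T ∣) (maxStable-size G α T-max) ⟨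
        ∣ T ∣ + ∣ ∁ T ∣  ≡⟨ ∣p∣+∣∁p∣≡n T ⟩
        n                ≡⟨ a+∣M∣≡n ⟨
        a + μ            ∎)
        where open ≡-Reasoning

      inside+outside≡2μ : inside + outside ≡ μ + μ
      inside+outside≡2μ = begin
        inside + outside
          ≡⟨ ∑-distrib-+ (λ x → χ T x * degree w x) _ ⟨
        sum (λ x → χ T x * degree w x + χ (∁ T) x * degree w x)
          ≡⟨ sum-cong-≗ (λ x → *-distribʳ-+ (degree w x) (χ T x) (χ (∁ T) x)) ⟨
        sum (λ x → (χ T x + χ (∁ T) x) * degree w x)
          ≡⟨ sum-cong-≗ (λ x → trans (cong (_* degree w x) (χ+χ∁≡1 {p = T})) (*-identityˡ _)) ⟩
        sum (degree w)
          ≡⟨ sum-degree-multiplicity G M ⟩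
        μ + μ ∎
        where open ≡-Reasoning

      edges-leave-T : ∀ x z → 0 < w x z → χ T x ≤ χ (∁ T) z
      edges-leave-T x z w>0 = χ-mono (stable⇒Adj⇒∈∁ G (proj₁ T-max)
        (support⇒Adj G (multiplicity-support G (proj₁ M-matching)) w>0))

      χ∁T*degree≤χ∁T : ∀ x → χ (∁ T) x * degree w x ≤ χ (∁ T) x
      χ∁T*degree≤χ∁T x = n≤1⇒m*n≤m (matching-degree≤1 G M-matching x)

      sum-χ∁T≡μ : sum (χ (∁ T)) ≡ μ
      sum-χ∁T≡μ = trans (sum-χ (∁ T)) ∣∁T∣≡μ

      -- Stability of T gives inside ≤ outside, while the μ vertices of ∁ T are matched at
      -- most once each; the 2μ matched endpoints then leave no slack in either inequality.
      balanced : inside ≡ outside × outside ≡ μ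
      balanced = +-squeeze
        (sum-*degree-mono-≤ w (multiplicity-sym M) edges-leave-T)
        (subst (outside ≤_) sum-χ∁T≡μ (sum-mono-≤ χ∁T*degree≤χ∁T))
        inside+outside≡2μ

    unmatched⇒∈maxStable : ∀ {u} → degree w u ≡ 0 → u ∈ T
    unmatched⇒∈maxStable {u} degree≡0 with u ∈? T
    ... | yes u∈T = u∈T
    ... | no  u∉T = contradiction (proj₂ balanced)
      (<⇒≢ (subst (outside <_) sum-χ∁T≡μ (sum-mono-< χ∁T*degree≤χ∁T u outside-loses)))
      where
      outside-loses : χ (∁ T) u * degree w u < χ (∁ T) u
      outside-loses rewrite χ-∈ (x∉p⇒x∈∁p u∉T) | degree≡0 = z<s

    matchingEdge⇒∈maxStable : ∀ {u v} → 0 < w u v → u ∉ T → v ∈ T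
    matchingEdge⇒∈maxStable {u} {v} w>0 u∉T with v ∈? T
    ... | yes v∈T = v∈T
    ... | no  v∉T = contradiction (proj₁ balanced)
      (<⇒≢ (sum-*degree-mono-< w (multiplicity-sym M) edges-leave-T u v w>0 edge-outside))
      where
      edge-outside : χ T u < χ (∁ T) v
      edge-outside = subst₂ _<_ (sym (χ-∉ u∉T)) (sym (χ-∈ (x∉p⇒x∈∁p v∉T))) z<s

  module _ {C} (C-core : IsCore G C) {D} (D-nbhd : IsNeighbourhood G C D) where

    unmatched⇒∈core : ∀ {u} → degree w u ≡ 0 → u ∈ C
    unmatched⇒∈core degree≡0 = ∈core G C-core (λ T-max → unmatched⇒∈maxStable T-max degree≡0)

    N[core]-matched : ∀ {y} → y ∈ D → 0 < degree w y
    N[core]-matched y∈D = n≢0⇒n>0 (λ degree≡0 →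
      let _ , S-max = α⇒maxStable G α
      in  N[core]∩maxStable≡∅ G C-core D-nbhd y∈D S-max (unmatched⇒∈maxStable S-max degree≡0))

    N[core]-partner∈core : ∀ {y c} → y ∈ D → 0 < w y c → c ∈ C
    N[core]-partner∈core y∈D w>0 =
      ∈core G C-core (λ T-max →
        matchingEdge⇒∈maxStable T-max w>0 (N[core]∩maxStable≡∅ G C-core D-nbhd y∈D T-max))

    unmatched⇒∣N[core]∣<∣core∣ : ∀ {u} → degree w u ≡ 0 → ∣ D ∣ < ∣ C ∣
    unmatched⇒∣N[core]∣<∣core∣ {u} degree≡0 = begin-strict
      ∣ D ∣                           ≡⟨ sum-χ D ⟨
      sum (χ D)                       ≤⟨ sum-mono-≤ (χ≤χ*f N[core]-matched) ⟩
      sum (λ y → χ D y * degree w y)  ≤⟨ sum-*degree-mono-≤ w (multiplicity-sym M) partner∈core ⟩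
      sum (λ c → χ C c * degree w c)  <⟨ sum-mono-< χC*degree≤χC u unmatched-in-core ⟩
      sum (χ C)                       ≡⟨ sum-χ C ⟩
      ∣ C ∣                           ∎
      where
      open ≤-Reasoning
      χC*degree≤χC : ∀ c → χ C c * degree w c ≤ χ C c
      χC*degree≤χC c = n≤1⇒m*n≤m (matching-degree≤1 G M-matching c)
      partner∈core : ∀ y c → 0 < w y c → χ D y ≤ χ C c
      partner∈core _ _ w>0 = χ-mono (λ y∈D → N[core]-partner∈core y∈D w>0)
      unmatched-in-core : χ C u * degree w u < χ C u
      unmatched-in-core rewrite χ-∈ (unmatched⇒∈core degree≡0) | degree≡0 = z<s

proposition6 : (n : ℕ) (G : SimpleGraph n) → IsKE G →
    (a : ℕ) → IsAlpha G a →
    (C : Subset n) → IsCore G C →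
    (D : Subset n) → IsNeighbourhood G C D →
      ((n < 2 * a) ⇔ (¬ HasPerfectMatching G))
    × ((¬ HasPerfectMatching G) ⇔ (¬ QuasiRegularizable G))
    × ((¬ QuasiRegularizable G) ⇔ (∣ D ∣ < ∣ C ∣))
proposition6 n G ke a α C C-core D D-nbhd with maximumMatching G
... | M , M-maximum@(M-matching , M-largest) =
    mk⇔ (from ¬perfect⇔2μ<n ∘ to n<2α⇔2μ<n) (from n<2α⇔2μ<n ∘ to ¬perfect⇔2μ<n)
  , mk⇔ ¬perfect⇒¬qr (λ ¬qr → ¬qr ∘ perfectMatching⇒quasiRegularizable G)
  , mk⇔ ¬qr⇒∣D∣<∣C∣ (λ ∣D∣<∣C∣ qr → <⇒≱ ∣D∣<∣C∣ (quasiRegularizable⇒∣p∣≤∣N[p]∣ G qr D-nbhd))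
  where
  open Equivalence

  a+μ≡n : a + length M ≡ n
  a+μ≡n = ke a (length M) α ((M , M-matching , refl) , M-largest)

  open KönigEgerváry G α M-matching a+μ≡n

  ¬perfect⇔2μ<n : (¬ HasPerfectMatching G) ⇔ (length M + length M < n)
  ¬perfect⇔2μ<n = ¬perfectMatching⇔2∣M∣<n G M-maximum

  n<2α⇔2μ<n : (n < 2 * a) ⇔ (length M + length M < n)
  n<2α⇔2μ<n = n<2*a⇔m+m<n {a} {length M} a+μ≡n

  ¬perfect⇒¬qr : ¬ HasPerfectMatching G → ¬ QuasiRegularizable G
  ¬perfect⇒¬qr ¬perfect qr =
    <⇒≱ (from n<2α⇔2μ<n (to ¬perfect⇔2μ<n ¬perfect)) (quasiRegularizable⇒2α≤n G α qr)

  ¬qr⇒∣D∣<∣C∣ : ¬ QuasiRegularizable G → ∣ D ∣ < ∣ C ∣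
  ¬qr⇒∣D∣<∣C∣ ¬qr =
    let _ , unmatched = 2∣M∣<n⇒unmatched G {M}
          (to ¬perfect⇔2μ<n (¬qr ∘ perfectMatching⇒quasiRegularizable G))
    in  unmatched⇒∣N[core]∣<∣core∣ C-core D-nbhd unmatched
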